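{- Let $j,k$ be positive integers with $\mathbf{B}_j^k$ finite and let $m = \max(\mathbf{B}_j^k)$. Suppose $\mathbf{B}_{j+1}^k = \{1\} \cup \{ n+1 : n \in \mathbf{B}_j^k\}$ and $\left\lfloor \sqrt[k]{(m-j)\left(1 + \frac{1}{2^k-1}\right)} \right\rfloor = \left\lfloor \sqrt[k]{m} \right\rfloor.$ Then $\mathbf{B}^k = \{ n - j : n \in \mathbf{B}_j^k,\ n > j\}$, and $\overline{\mathbf{B}_l^k} = \emptyset$ for all $l \ge j$.
   Context: For positive integers $j,k$, a positive integer $n$ is called $(j,k)$-representable if $n = x_1^k + \cdots + x_j^k$ with all $x_i$ positive integers. Let $\mathbf{B}_j^k$ denote the set of positive integers that are not $(j,k)$-representable, and put $S_j^k = \{ n - j : n \in \mathbf{B}_j^k,\ n > j\}$. Define $\mathbf{B}^k = \bigcap_{j \ge 1} S_j^k$ (the eventual common value of the non-increasing chain $S_j^k$) and $\overline{\mathbf{B}_j^k} = S_j^k \setminus \mathbf{B}^k$. -}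

module Defs where

open import Data.Nat using (ℕ; zero; suc; _+_; _*_; _∸_; _^_; _≤_; _<_)
open import Data.Vec using (Vec; map; sum; lookup)
open import Data.Fin using (Fin)
open import Data.Product using (Σ; _×_)
open import Relation.Nullary using (¬_)

Representable : ℕ → ℕ → ℕ → Set
Representable j k n =
  Σ (Vec ℕ j) λ xs → ((i : Fin j) → 1 ≤ lookup xs i) × (sum (map (λ x → x ^ k) xs) ≡ n)
  where open import Relation.Binary.PropositionalEquality using (_≡_)

InB : ℕ → ℕ → ℕ → Set
InB j k n = (1 ≤ n) × ¬ Representable j k n

-- membership in S_j^k = { n - j : n ∈ B_j^k, n > j }.
-- d ∈ S_j^k  iff  d = n - j for some n ∈ B_j^k with n > j, i.e. d ≥ 1 and d + j ∈ B_j^k.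
InS : ℕ → ℕ → ℕ → Set
InS j k d = (1 ≤ d) × InB j k (d + j)

InBinf : ℕ → ℕ → Set
InBinf k d = (j : ℕ) → 1 ≤ j → InS j k d

InBbar : ℕ → ℕ → ℕ → Set
InBbar j k d = InS j k d × ¬ InBinf k d

-- r = ⌊ (p/q)^(1/k) ⌋ for a nonnegative rational p/q (q > 0):
-- r is the largest natural number with r^k ≤ p/q.
IsFloorRoot : ℕ → ℕ → ℕ → ℕ → Set
IsFloorRoot k p q r = (r ^ k * q ≤ p) × (p < suc r ^ k * q)

-- Let d ∈ S_j ∩ S_{j+1} ∩ S_l and suppose d + l + 1 = x^k + R with R a sum of l positive
-- k-th powers, so R = d′ + l.  Then d + j + 1 = x^k + (d′ + j), and since d ∈ S_{j+1}
-- the number d′ + j is not a sum of j positive k-th powers: d′ = 0 is impossible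
-- (j = 1^k + ⋯ + 1^k), so d′ ∈ S_j ⊆ S_l, contradicting R = d′ + l.  Hence S_j ⊆ S_{j+1}
-- alone forces S_j ⊆ S_l for every l ≥ j, by induction on l; the chain is non-increasing,
-- so it is constant from j on and equals B^k.
-- The hypothesis on B_{j+1}^k is used only to get S_j ⊆ S_{j+1}.
module Submission where

open import Defs
open import Data.Nat using (ℕ; zero; suc; _+_; _*_; _∸_; _^_; _≤_; _≤′_; ≤′-refl; ≤′-step; z≤n; s≤s)
open import Data.Nat.Properties
open import Data.Vec using (_∷_; [])
open import Data.Fin using (Fin) renaming (zero to fzero; suc to fsuc)
open import Data.Product using (Σ; ∃; _×_; _,_; proj₁)
open import Data.Sum using (_⊎_; inj₁; inj₂)
open import Function using (id; _∘_)
open import Function.Bundles using (_⇔_; mk⇔; Equivalence)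
open import Relation.Nullary using (¬_)
open import Relation.Unary using (_⊆_)
open import Relation.Binary.PropositionalEquality using (_≡_; refl; sym; trans; cong; subst; module ≡-Reasoning)

module _ (k : ℕ) where

  Representable-∷ : ∀ {j n} x → 1 ≤ x → Representable j k n → Representable (suc j) k (x ^ k + n)
  Representable-∷ {j} x x≥1 (xs , xs≥1 , Σxs≡n) = x ∷ xs , all≥1 , cong (x ^ k +_) Σxs≡n
    where
    all≥1 : (i : Fin (suc j)) → 1 ≤ _
    all≥1 fzero = x≥1
    all≥1 (fsuc i) = xs≥1 i

  Representable-ones : ∀ j → Representable j k j
  Representable-ones zero = [] , (λ ()) , refl
  Representable-ones (suc j) =
    subst (Representable (suc j) k) (cong (_+ j) (^-zeroˡ k)) (Representable-∷ 1 (s≤s z≤n) (Representable-ones j))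

  Representable-uncons : ∀ {j n} → Representable (suc j) k n →
    ∃ λ x → 1 ≤ x × ∃ λ R → Representable j k R × n ≡ x ^ k + R
  Representable-uncons (x ∷ xs , all≥1 , Σ≡n) =
    x , all≥1 fzero , _ , (xs , (λ i → all≥1 (fsuc i)) , refl) , sym Σ≡n

  Representable⇒≤ : ∀ {j n} → Representable j k n → j ≤ n
  Representable⇒≤ {zero} _ = z≤n
  Representable⇒≤ {suc j} r with Representable-uncons r
  ... | zero , () , _
  ... | suc x , _ , R , r′ , n≡ =
    subst (suc j ≤_) (sym n≡) (+-mono-≤ (m^n>0 (suc x) k) (Representable⇒≤ r′))

  InS-intro : ∀ {l d} → 1 ≤ d → ¬ Representable l k (d + l) → InS l k d
  InS-intro {l} {d} d≥1 d+l∉ = d≥1 , ≤-trans d≥1 (m≤m+n d l) , d+l∉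

  InS-notRepresentable : ∀ {l d} → InS l k d → ¬ Representable l k (d + l)
  InS-notRepresentable (_ , _ , d+l∉) = d+l∉

  Representable-peel : ∀ {l d} → Representable (suc l) k (d + suc l) →
    ∃ λ x → 1 ≤ x × ∃ λ d′ → suc d ≡ x ^ k + d′ × Representable l k (d′ + l)
  Representable-peel {l} {d} r with Representable-uncons r
  ... | x , x≥1 , R , rR , d+1+l≡ = x , x≥1 , R ∸ l , +-cancelʳ-≡ l _ _ shifted , subst (Representable l k) (sym R≡) rR
    where
    open ≡-Reasoning
    R≡ : R ∸ l + l ≡ R
    R≡ = m∸n+n≡m (Representable⇒≤ rR)
    shifted : suc d + l ≡ x ^ k + (R ∸ l) + l
    shifted = begin
      suc d + l              ≡⟨ sym (+-suc d l) ⟩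
      d + suc l              ≡⟨ d+1+l≡ ⟩
      x ^ k + R              ≡⟨ cong (x ^ k +_) (sym R≡) ⟩
      x ^ k + (R ∸ l + l)    ≡⟨ sym (+-assoc (x ^ k) (R ∸ l) l) ⟩
      x ^ k + (R ∸ l) + l    ∎

  Representable-unpeel : ∀ {l d d′} x → 1 ≤ x → suc d ≡ x ^ k + d′ →
    Representable l k (d′ + l) → Representable (suc l) k (d + suc l)
  Representable-unpeel {l} {d} {d′} x x≥1 d+1≡ r = subst (Representable (suc l) k) sum≡ (Representable-∷ x x≥1 r)
    where
    open ≡-Reasoning
    sum≡ : x ^ k + (d′ + l) ≡ d + suc l
    sum≡ = begin
      x ^ k + (d′ + l)   ≡⟨ sym (+-assoc (x ^ k) d′ l) ⟩
      x ^ k + d′ + l     ≡⟨ cong (_+ l) (sym d+1≡) ⟩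
      suc d + l          ≡⟨ +-suc d l ⟨
      d + suc l          ∎

  InS-suc⇒InS : ∀ {l} → InS (suc l) k ⊆ InS l k
  InS-suc⇒InS {l} {d} (d≥1 , _ , d+1+l∉) =
    InS-intro d≥1 (λ r → d+1+l∉ (Representable-unpeel 1 (s≤s z≤n) (sym (cong (_+ d) (^-zeroˡ k))) r))

  InS-antitone′ : ∀ {l l′} → l ≤′ l′ → InS l′ k ⊆ InS l k
  InS-antitone′ ≤′-refl = id
  InS-antitone′ (≤′-step l≤l′) = InS-antitone′ l≤l′ ∘ InS-suc⇒InS

  InS-antitone : ∀ {l l′} → l ≤ l′ → InS l′ k ⊆ InS l k
  InS-antitone l≤l′ = InS-antitone′ (≤⇒≤′ l≤l′)

  InS-⊆-suc : ∀ {j l} → InS j k ⊆ InS (suc j) k → InS j k ⊆ InS l k → InS j k ⊆ InS (suc l) k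
  InS-⊆-suc {j} {l} Sⱼ⊆Sⱼ₊₁ Sⱼ⊆Sₗ {d} d∈Sⱼ = InS-intro (proj₁ d∈Sⱼ) d+1+l∉
    where
    d+1+j∉ : ¬ Representable (suc j) k (d + suc j)
    d+1+j∉ = InS-notRepresentable (Sⱼ⊆Sⱼ₊₁ d∈Sⱼ)
    d+1+l∉ : ¬ Representable (suc l) k (d + suc l)
    d+1+l∉ r with Representable-peel r
    ... | x , x≥1 , zero , d+1≡ , _ = d+1+j∉ (Representable-unpeel x x≥1 d+1≡ (Representable-ones j))
    ... | x , x≥1 , suc d′ , d+1≡ , r′ =
      InS-notRepresentable (Sⱼ⊆Sₗ (InS-intro (s≤s z≤n) (d+1+j∉ ∘ Representable-unpeel x x≥1 d+1≡))) r′

  InS-stable′ : ∀ {j l} → InS j k ⊆ InS (suc j) k → j ≤′ l → InS j k ⊆ InS l k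
  InS-stable′ _ ≤′-refl = id
  InS-stable′ Sⱼ⊆Sⱼ₊₁ (≤′-step j≤l) = InS-⊆-suc Sⱼ⊆Sⱼ₊₁ (InS-stable′ Sⱼ⊆Sⱼ₊₁ j≤l)

  InS-⊆-InBinf : ∀ {j} → InS j k ⊆ InS (suc j) k → InS j k ⊆ InBinf k
  InS-⊆-InBinf {j} Sⱼ⊆Sⱼ₊₁ d∈Sⱼ l _ with ≤-total l j
  ... | inj₁ l≤j = InS-antitone l≤j d∈Sⱼ
  ... | inj₂ j≤l = InS-stable′ Sⱼ⊆Sⱼ₊₁ (≤⇒≤′ j≤l) d∈Sⱼ

  InB-shift⇒InS-⊆ : ∀ {j} → (∀ {n} → InB j k n → InB (suc j) k (n + 1)) → InS j k ⊆ InS (suc j) k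
  InB-shift⇒InS-⊆ {j} shift {d} (d≥1 , d+j∈B) =
    d≥1 , subst (InB (suc j) k) (trans (+-comm (d + j) 1) (sym (+-suc d j))) (shift d+j∈B)

theorem10p17 : (j k : ℕ) → 1 ≤ j → 1 ≤ k →
    (m : ℕ) → InB j k m → ((n : ℕ) → InB j k n → n ≤ m) →
    ((n : ℕ) → InB (suc j) k n ⇔ (n ≡ 1 ⊎ Σ ℕ (λ n′ → InB j k n′ × n ≡ n′ + 1))) →
    Σ ℕ (λ r → IsFloorRoot k ((m ∸ j) * 2 ^ k) (2 ^ k ∸ 1) r × IsFloorRoot k m 1 r) →
    ((d : ℕ) → InBinf k d ⇔ InS j k d)
    × ((l : ℕ) → j ≤ l → (d : ℕ) → ¬ InBbar l k d)
theorem10p17 j k j≥1 _ _ _ _ Bⱼ₊₁≡ _ = (λ d → mk⇔ (λ d∈B → d∈B j j≥1) Sⱼ⊆B) , Bbar-empty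
  where
  Sⱼ⊆B : InS j k ⊆ InBinf k
  Sⱼ⊆B = InS-⊆-InBinf k (InB-shift⇒InS-⊆ k (λ {n} n∈Bⱼ → Equivalence.from (Bⱼ₊₁≡ (n + 1)) (inj₂ (n , n∈Bⱼ , refl))))
  Bbar-empty : (l : ℕ) → j ≤ l → (d : ℕ) → ¬ InBbar l k d
  Bbar-empty l j≤l d (d∈Sₗ , d∉B) = d∉B (Sⱼ⊆B (InS-antitone k j≤l d∈Sₗ))
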